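{- Let $G$ be a $2$-connected simple graph and let $\{u,v\}$ be a $2$-vertex cut of $G$. If $G$ has a fundamental Tutte tree, then there are at most three $\{u,v\}$-bridges in $G$.
   Context: For a proper subgraph $H$ of a connected graph $G$, an $H$-bridge is either an edge of $E(G)\setminus E(H)$ with both ends in $V(H)$, or a component $C$ of $G-H$ together with all edges joining $C$ to $H$; a $\{u,v\}$-bridge is an $H$-bridge where $H$ consists of the two vertices $u,v$ only. For a spanning tree $T$ of $G$ and $e\in E(G)\setminus E(T)$, the fundamental cycle $C_e$ is the unique cycle in $T+e$. A cycle $C$ is nonseparating if $G-C$ (the subgraph induced by $V(G)\setminus V(C)$) is connected; by convention a Hamiltonian cycle is nonseparating. A fundamental Tutte tree is a spanning tree all of whose fundamental cycles are nonseparating. -}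

module Defs where

open import Data.Nat using (ℕ; _≤_)
open import Data.Fin using (Fin)
open import Data.Bool using (Bool; true)
open import Data.List using (List; []; _∷_; length)
open import Data.List.Relation.Unary.Unique.Propositional using (Unique)
open import Data.List.Membership.Propositional using (_∈_)
open import Data.Product using (Σ; _×_; ∃; ∃-syntax)
open import Relation.Binary.PropositionalEquality using (_≡_; _≢_)
open import Relation.Nullary using (¬_)
open import Data.Unit using (⊤)
open import Data.Empty using (⊥)

record Graph : Set where
  field
    n     : ℕ
    adj   : Fin n → Fin n → Bool
    sym   : ∀ x y → adj x y ≡ adj y x
    irref : ∀ x → ¬ (adj x x ≡ true)

module _ (G : Graph) where
  open Graph G

  V : Set
  V = Fin n

  Adj : V → V → Set
  Adj x y = adj x y ≡ true

  data Walk (E : V → V → Set) : V → V → List V → Set where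
    nil  : ∀ {x} → Walk E x x (x ∷ [])
    cons : ∀ {x y z vs} → E x y → Walk E y z vs → Walk E x z (x ∷ vs)

  InducedAdj : (V → Set) → V → V → Set
  InducedAdj S x y = Adj x y × S x × S y

  -- The subgraph of G induced by S is connected (vacuously if S is empty).
  ConnectedOn : (V → Set) → Set
  ConnectedOn S = ∀ a b → S a → S b → ∃[ vs ] Walk (InducedAdj S) a b vs

  Connected : Set
  Connected = ConnectedOn (λ _ → ⊤)

  TwoConnected : Set
  TwoConnected = 3 ≤ n × Connected × (∀ v → ConnectedOn (λ x → x ≢ v))

  TwoVertexCut : V → V → Set
  TwoVertexCut u v = u ≢ v × ¬ ConnectedOn (λ x → x ≢ u × x ≢ v)

  TE : (V → V → Bool) → V → V → Set
  TE T x y = T x y ≡ true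

  HasCycle : (V → V → Set) → Set
  HasCycle E = Σ V λ x → Σ V λ y → Σ (List V) λ vs →
    Walk E x y vs × Unique vs × 3 ≤ length vs × E y x

  SpanningTree : (V → V → Bool) → Set
  SpanningTree T =
    (∀ x y → T x y ≡ T y x) ×
    (∀ x y → TE T x y → Adj x y) ×
    (∀ a b → ∃[ vs ] Walk (TE T) a b vs) ×
    ¬ HasCycle (TE T)

  -- Vertex set of the fundamental cycle C_e for e = xy ∉ E(T): the cycle in T+e
  -- consists of e together with the (unique) path of T from x to y,
  -- so its vertices are those on that T-path.
  OnFundCycle : (V → V → Bool) → V → V → V → Set
  OnFundCycle T x y w = ∃[ vs ] (Walk (TE T) x y vs × Unique vs × w ∈ vs)

  -- C is nonseparating: G - V(C) is connected (Hamiltonian cycles included, vacuously).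
  NonseparatingFundCycle : (V → V → Bool) → V → V → Set
  NonseparatingFundCycle T x y = ConnectedOn (λ w → ¬ OnFundCycle T x y w)

  FundamentalTutteTree : (V → V → Bool) → Set
  FundamentalTutteTree T =
    SpanningTree T ×
    (∀ x y → Adj x y → ¬ TE T x y → NonseparatingFundCycle T x y)

  HasFundamentalTutteTree : Set
  HasFundamentalTutteTree = ∃[ T ] FundamentalTutteTree T

  -- {u,v}-bridges (H = the two vertices u, v, no edges): either the edge uv
  -- (if present), or a component of G - {u,v} together with its edges to u, v.
  -- A bridge is represented by the edge uv, or by a vertex of its component.
  data BridgeRep (u v : V) : Set where
    edgeBr : Adj u v → BridgeRep u v
    compBr : (x : V) → x ≢ u → x ≢ v → BridgeRep u v

  SameBridge : (u v : V) → BridgeRep u v → BridgeRep u v → Set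
  SameBridge u v (edgeBr _)     (edgeBr _)     = ⊤
  SameBridge u v (edgeBr _)     (compBr _ _ _) = ⊥
  SameBridge u v (compBr _ _ _) (edgeBr _)     = ⊥
  SameBridge u v (compBr x _ _) (compBr y _ _) =
    ∃[ vs ] Walk (InducedAdj (λ w → w ≢ u × w ≢ v)) x y vs

  AtMostThreeBridges : V → V → Set
  AtMostThreeBridges u v =
    ¬ (Σ (Fin 4 → BridgeRep u v) λ f →
         ∀ i j → i ≢ j → ¬ SameBridge u v (f i) (f j))

-- Fix the tree path P from u to v.  At most one component of G - {u,v} meets P, since
-- the interior of P lies in G - {u,v}.  Let D be a component avoiding P.  Each vertex
-- x of D is on the u-side or the v-side: the tree path from x to u, or the one to v,
-- runs inside D until its end.  Not both, or the first followed by P would be a second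
-- tree path to v.  As G - u and G - v are connected, D has vertices on both sides or
-- a vertex on one side adjacent to the other terminal, so some edge xy joins the
-- u-side to the v-side with an end in D.  It is not a tree edge, and its fundamental
-- cycle (x to u in T, then P, then v to y in T) contains u and v and lies in D ∪ P.
-- Being nonseparating, it leaves any two further components avoiding P connected in
-- G - {u,v}: absurd.  If uv is an edge, either it lies in T and no component meets P,
-- or P closes to its fundamental cycle, so already two components avoiding P clash.
module Submission where

open import Defs
open import Data.Nat using (_≤_; z≤n; s≤s)
open import Data.Fin using (zero; suc; _≟_)
open import Data.Bool using (Bool; true)
import Data.Bool as Bool
open import Data.List using (List; []; _∷_; length; _++_; drop; reverse)
open import Data.List.Properties using (unfold-reverse)
open import Data.List.Relation.Unary.All using ([]; _∷_)
open import Data.List.Relation.Unary.All.Properties using (All¬⇒¬Any; ¬Any⇒All¬)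
open import Data.List.Relation.Unary.Any using (here; there)
import Data.List.Relation.Unary.Any.Properties as Any
open import Data.List.Relation.Unary.AllPairs using ([]; _∷_)
open import Data.List.Relation.Unary.Unique.Propositional using (Unique)
import Data.List.Relation.Unary.Unique.Propositional.Properties as Unique
open import Data.List.Relation.Binary.Disjoint.Propositional using (Disjoint)
open import Data.List.Relation.Binary.Subset.Propositional using (_⊆_)
open import Data.List.Relation.Binary.Permutation.Setoid using (↭-sym)
open import Data.List.Relation.Binary.Permutation.Setoid.Properties using (Unique-resp-↭; ↭-reverse)
open import Data.List.Membership.Propositional using (_∈_; _∉_)
open import Data.List.Membership.Propositional.Properties using (∈-++⁺ˡ; ∈-++⁺ʳ; ∈-++⁻)
open import Data.Product using (Σ-syntax; _×_; _,_; proj₁; proj₂; ∃-syntax)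
open import Data.Sum using (_⊎_; inj₁; inj₂; [_,_]′; swap)
open import Data.Unit using (tt)
open import Data.Empty using (⊥; ⊥-elim)
open import Function using (_∘_; id)
open import Relation.Binary.PropositionalEquality using (_≡_; _≢_; refl; sym; trans; cong; subst; setoid)
open import Relation.Nullary using (¬_; Dec; yes; no)
open import Relation.Nullary.Decidable using (_⊎-dec_; ¬¬-excluded-middle)
open import Relation.Unary using (∁; Decidable)

unique-reverse : ∀ {A : Set} {xs : List A} → Unique xs → Unique (reverse xs)
unique-reverse {A} {xs} = Unique-resp-↭ (setoid A) (↭-sym (setoid A) (↭-reverse (setoid A) xs))

module Walks (G : Graph) where
  open import Data.List.Membership.DecPropositional (_≟_ {Graph.n G}) using (_∈?_)

  -- A walk along Departing S E has all its vertices but the last in S.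
  Departing : (V G → Set) → (V G → V G → Set) → V G → V G → Set
  Departing S E x y = S x × E x y

  Subpath : (V G → V G → Set) → V G → V G → List (V G) → Set
  Subpath E a b vs = Σ[ ws ∈ List (V G) ] Walk G E a b ws × Unique ws × ws ⊆ vs

  private variable
    E E′ : V G → V G → Set
    R S S′ S₁ S₂ : V G → Set
    a b c z : V G
    vs ws : List (V G)

  Adj-sym : Adj G a b → Adj G b a
  Adj-sym {a} {b} e = trans (sym (Graph.sym G a b)) e

  start∈ : Walk G E a b vs → a ∈ vs
  start∈ nil = here refl
  start∈ (cons _ _) = here refl

  end∈ : Walk G E a b vs → b ∈ vs
  end∈ nil = here refl
  end∈ (cons _ p) = there (end∈ p)

  drop1⊆ : drop 1 vs ⊆ vs
  drop1⊆ {_ ∷ _} = there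

  ∈-drop1 : Walk G E a b vs → z ∈ vs → z ≢ a → z ∈ drop 1 vs
  ∈-drop1 nil (here z≡a) z≢a = ⊥-elim (z≢a z≡a)
  ∈-drop1 (cons _ _) (here z≡a) z≢a = ⊥-elim (z≢a z≡a)
  ∈-drop1 (cons _ _) (there k) _ = k

  start∉drop1 : Walk G E a b vs → Unique vs → a ∉ drop 1 vs
  start∉drop1 (cons _ _) (a∉ ∷ _) = All¬⇒¬Any a∉

  map : (∀ {x y} → E x y → E′ x y) → Walk G E a b vs → Walk G E′ a b vs
  map f nil = nil
  map f (cons e p) = cons (f e) (map f p)

  induced-mono : (∀ {x} → S x → S′ x) →
    Walk G (InducedAdj G S) a b vs → Walk G (InducedAdj G S′) a b vs
  induced-mono f = map λ { (e , sx , sy) → e , f sx , f sy }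

  induced-vertices : Walk G (InducedAdj G S) a b vs → S a → z ∈ vs → S z
  induced-vertices nil sa (here refl) = sa
  induced-vertices (cons _ _) sa (here refl) = sa
  induced-vertices (cons (_ , _ , sy) p) _ (there k) = induced-vertices p sy k

  infixr 5 _++ʷ_
  _++ʷ_ : Walk G E a b vs → Walk G E b c ws → Walk G E a c (vs ++ drop 1 ws)
  nil ++ʷ nil = nil
  nil ++ʷ cons e q = cons e q
  cons e p ++ʷ q = cons e (p ++ʷ q)

  reverseʷ : (∀ {x y} → E x y → E y x) → Walk G E a b vs → Walk G E b a (reverse vs)
  reverseʷ E-sym nil = nil
  reverseʷ E-sym (cons {x = a} {vs = vs} e p) =
    subst (Walk G _ _ _) (sym (unfold-reverse a vs)) (reverseʷ E-sym p ++ʷ cons (E-sym e) nil)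

  departing-vertices : Walk G (Departing S E) a b vs → z ∈ vs → z ≡ b ⊎ S z
  departing-vertices nil (here refl) = inj₁ refl
  departing-vertices (cons (sa , _) _) (here refl) = inj₂ sa
  departing-vertices (cons _ p) (there k) = departing-vertices p k

  departing-mono : (∀ {z} → z ∈ vs → S z → S′ z) →
    Walk G (Departing S E) a b vs → Walk G (Departing S′ E) a b vs
  departing-mono f nil = nil
  departing-mono f (cons (sa , e) p) = cons (f (here refl) sa , e) (departing-mono (f ∘ there) p)

  path-departs-before-end : Walk G E a b vs → Unique vs → Walk G (Departing (_≢ b) E) a b vs
  path-departs-before-end nil _ = nil
  path-departs-before-end (cons e p) (a∉ ∷ p!) =
    cons ((λ { refl → All¬⇒¬Any a∉ (end∈ p) }) , e) (path-departs-before-end p p!)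

  suffix : Walk G E a b vs → Unique vs → z ∈ vs → Subpath E z b vs
  suffix nil vs! (here refl) = _ , nil , vs! , id
  suffix (cons e p) vs! (here refl) = _ , cons e p , vs! , id
  suffix (cons e p) (_ ∷ p!) (there k) =
    let ws , q , ws! , ws⊆ = suffix p p! k in ws , q , ws! , there ∘ ws⊆

  toPath : Walk G E a b vs → Subpath E a b vs
  toPath nil = _ , nil , [] ∷ [] , id
  toPath (cons {x = a} e p) with toPath p
  ... | ws , q , ws! , ws⊆ with a ∈? ws
  ...   | yes a∈ws = let ws′ , q′ , ws′! , ws′⊆ = suffix q ws! a∈ws in ws′ , q′ , ws′! , there ∘ ws⊆ ∘ ws′⊆
  ...   | no a∉ws = a ∷ ws , cons e q , ¬Any⇒All¬ ws a∉ws ∷ ws! ,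
          λ { (here refl) → here refl ; (there k) → there (ws⊆ k) }

  prefixUntil : {P : V G → Set} → Decidable P → Walk G E a b vs → P b →
    Σ[ w ∈ V G ] P w × Σ[ ws ∈ List (V G) ] Walk G (Departing (∁ P) E) a w ws × ws ⊆ vs
  prefixUntil P? nil pb = _ , pb , _ , nil , id
  prefixUntil P? (cons {x = a} e p) pb with P? a
  ... | yes pa = a , pa , _ , nil , λ { (here refl) → here refl ; (there ()) }
  ... | no ¬pa = let w , pw , ws , q , ws⊆ = prefixUntil P? p pb in
    w , pw , a ∷ ws , cons (¬pa , e) q , λ { (here refl) → here refl ; (there k) → there (ws⊆ k) }

  crossing-edge : (∀ {x} → S₁ x → S₂ x → ⊥) → (∀ {x} → R x → S₁ x ⊎ S₂ x) →
    Walk G (Departing R E) a b vs → S₁ a → S₂ b →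
    Σ[ x ∈ V G ] Σ[ y ∈ V G ] R x × S₁ x × S₂ y × E x y
  crossing-edge disj split nil s₁ s₂ = ⊥-elim (disj s₁ s₂)
  crossing-edge disj split (cons (ra , e) nil) s₁ s₂ = _ , _ , ra , s₁ , s₂ , e
  crossing-edge disj split (cons (ra , e) p@(cons (ry , _) _)) s₁ s₂ =
    [ (λ s₁′ → crossing-edge disj split p s₁′ s₂) , (λ s₂′ → _ , _ , ra , s₁ , s₂′ , e) ]′ (split ry)

module Forest (G : Graph) {E : V G → V G → Set}
  (E-sym : ∀ {x y} → E x y → E y x) (acyclic : ¬ HasCycle G E) where
  open Walks G
  open import Data.List.Membership.DecPropositional (_≟_ {Graph.n G}) using (_∈?_)

  private variable
    a b c d w : V G
    ps qs rs : List (V G)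

  private
    three≤length : c ∈ d ∷ rs → c ≢ d → 3 ≤ length (a ∷ d ∷ rs)
    three≤length (here c≡d) c≢d = ⊥-elim (c≢d c≡d)
    three≤length {rs = _ ∷ _} (there _) _ = s≤s (s≤s (s≤s z≤n))

    cycle-length : ∀ {E′} → Walk G E′ d w qs → c ∈ qs ++ rs → c ≢ d → 3 ≤ length (a ∷ qs ++ rs)
    cycle-length {a = a} nil = three≤length {a = a}
    cycle-length {a = a} (cons _ _) = three≤length {a = a}

    -- Two paths to b leaving a along different edges: follow the second until it first
    -- meets the first, then return along the first.
    cycle-from-fork : E a c → Walk G E c b ps → E a d → Walk G E d b qs →
      a ∉ ps → a ∉ qs → Unique ps → c ≢ d → HasCycle G E
    cycle-from-fork {a} {c} {ps = ps} e₁ p e₂ q a∉ps a∉qs ps! c≢d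
      with w , w∈ps , _ , q₁ , qs₁⊆ ← prefixUntil (_∈? ps) q (end∈ p)
      with qs′ , q′ , qs′! , qs′⊆ ← toPath q₁
      with rs , r , rs! , rs⊆ ← suffix (reverseʷ E-sym p) (unique-reverse ps!) (Any.reverse⁺ w∈ps) =
      a , c , a ∷ qs′ ++ drop 1 rs , cons e₂ (map proj₂ q′ ++ʷ r) ,
      ¬Any⇒All¬ _ ([ a∉qs ∘ qs₁⊆ ∘ qs′⊆ , a∉ps ∘ on-p ∘ drop1⊆ ]′ ∘ ∈-++⁻ qs′)
        ∷ Unique.++⁺ qs′! (Unique.drop⁺ 1 rs!) disjoint ,
      cycle-length {a = a} q′ c∈ c≢d , E-sym e₁
      where
        on-p : rs ⊆ ps
        on-p = Any.reverse⁻ {xs = ps} ∘ rs⊆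
        disjoint : Disjoint qs′ (drop 1 rs)
        disjoint (k₁ , k₂) with departing-vertices q′ k₁
        ... | inj₁ refl = start∉drop1 r rs! k₂
        ... | inj₂ ∉ps = ∉ps (on-p (drop1⊆ k₂))
        c∈ : c ∈ qs′ ++ drop 1 rs
        c∈ with c ≟ w
        ... | yes refl = ∈-++⁺ˡ (end∈ q′)
        ... | no c≢w = ∈-++⁺ʳ qs′ (∈-drop1 r (end∈ r) c≢w)

  path-unique : Walk G E a b ps → Walk G E a b qs → Unique ps → Unique qs → ps ≡ qs
  path-unique nil nil _ _ = refl
  path-unique nil (cons _ q) _ (a∉ ∷ _) = ⊥-elim (All¬⇒¬Any a∉ (end∈ q))
  path-unique (cons _ p) nil (a∉ ∷ _) _ = ⊥-elim (All¬⇒¬Any a∉ (end∈ p))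
  path-unique (cons {y = c} e₁ p) (cons {y = d} e₂ q) (a∉p ∷ p!) (a∉q ∷ q!) with c ≟ d
  ... | yes refl = cong (_ ∷_) (path-unique p q p! q!)
  ... | no c≢d = ⊥-elim (acyclic (cycle-from-fork e₁ p e₂ q (All¬⇒¬Any a∉p) (All¬⇒¬Any a∉q) p! c≢d))

module Separation (G : Graph) (u v : V G) where
  open Walks G

  private variable
    E : V G → V G → Set
    a b c w z z₁ z₂ : V G
    vs : List (V G)

  Inner : V G → Set
  Inner z = z ≢ u × z ≢ v

  Terminal : V G → Set
  Terminal z = z ≡ u ⊎ z ≡ v

  terminal? : Decidable Terminal
  terminal? z = (z ≟ u) ⊎-dec (z ≟ v)

  terminal-≢u : Terminal w → w ≢ u → w ≡ v
  terminal-≢u (inj₁ w≡u) w≢u = ⊥-elim (w≢u w≡u)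
  terminal-≢u (inj₂ w≡v) _ = w≡v

  terminal-≢v : Terminal w → w ≢ v → w ≡ u
  terminal-≢v (inj₁ w≡u) _ = w≡u
  terminal-≢v (inj₂ w≡v) w≢v = ⊥-elim (w≢v w≡v)

  infix 4 _~_
  _~_ : V G → V G → Set
  x ~ y = ∃[ vs ] Walk G (InducedAdj G Inner) x y vs

  InComponent : V G → V G → Set
  InComponent c z = Inner z × c ~ z

  ~-refl : a ~ a
  ~-refl = _ , nil

  ~-sym : a ~ b → b ~ a
  ~-sym (_ , p) = _ , reverseʷ (λ { (e , sx , sy) → Adj-sym e , sy , sx }) p

  ~-trans : a ~ b → b ~ c → a ~ c
  ~-trans (_ , p) (_ , q) = _ , p ++ʷ q

  module _ (E⊆G : ∀ {x y} → E x y → Adj G x y) where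

    linked-to-start : Walk G (Departing Inner E) a b vs → z ∈ vs → Inner z → a ~ z
    linked-to-start nil (here refl) _ = ~-refl
    linked-to-start (cons _ _) (here refl) _ = ~-refl
    linked-to-start (cons (ia , e) nil) (there (here refl)) iz = _ , cons (E⊆G e , ia , iz) nil
    linked-to-start (cons _ nil) (there (there ()))
    linked-to-start (cons (ia , e) p@(cons (iy , _) _)) (there k) iz =
      ~-trans (_ , cons (E⊆G e , ia , iy) nil) (linked-to-start p k iz)

    inner-vertices-linked : Walk G (Departing Inner E) a b vs →
      z₁ ∈ vs → z₂ ∈ vs → Inner z₁ → Inner z₂ → z₁ ~ z₂
    inner-vertices-linked p k₁ k₂ i₁ i₂ = ~-trans (~-sym (linked-to-start p k₁ i₁)) (linked-to-start p k₂ i₂)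

    path-interior-linked : Walk G (Departing (_≢ v) E) a v vs → u ∉ drop 1 vs →
      z₁ ∈ drop 1 vs → z₂ ∈ drop 1 vs → Inner z₁ → Inner z₂ → z₁ ~ z₂
    path-interior-linked nil _ ()
    path-interior-linked (cons _ p) u∉ =
      inner-vertices-linked (departing-mono (λ k z≢v → (λ { refl → u∉ k }) , z≢v) p)

    exit-component : Walk G E a b vs → Terminal b → c ~ a →
      Σ[ w ∈ V G ] Terminal w × Σ[ ws ∈ List (V G) ] Walk G (Departing (InComponent c) E) a w ws × ws ⊆ vs
    exit-component p b-terminal c~a
      with w , w-terminal , ws , q , ws⊆ ← prefixUntil terminal? p b-terminal =
      w , w-terminal , ws , departing-mono (λ k iz → iz , ~-trans c~a (linked-to-start q′ k iz)) q′ , ws⊆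
      where
        q′ : Walk G (Departing Inner E) _ w ws
        q′ = departing-mono (λ _ ¬t → (¬t ∘ inj₁) , (¬t ∘ inj₂)) q

module TutteTree (G : Graph) (u v : V G) (u≢v : u ≢ v)
  (T : V G → V G → Bool) (tree : SpanningTree G T)
  (fundamental : ∀ x y → Adj G x y → ¬ TE G T x y → NonseparatingFundCycle G T x y)
  (no-cut-vertex : ∀ w → ConnectedOn G (λ x → x ≢ w))
  {Pl : List (V G)} (P : Walk G (TE G T) u v Pl) (P! : Unique Pl) where
  open Walks G
  open Separation G u v

  private variable
    a b c x y z : V G
    Q : List (V G)

  Tree : V G → V G → Set
  Tree = TE G T

  Tree-sym : Tree x y → Tree y x
  Tree-sym {x} {y} e = trans (sym (proj₁ tree x y)) e

  Tree⊆G : Tree x y → Adj G x y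
  Tree⊆G = proj₁ (proj₂ tree) _ _

  tree-spans : ∀ a b → ∃[ vs ] Walk G Tree a b vs
  tree-spans = proj₁ (proj₂ (proj₂ tree))

  open Forest G Tree-sym (proj₂ (proj₂ (proj₂ tree))) using (path-unique)

  Meets : V G → Set
  Meets c = ∃[ z ] z ∈ Pl × InComponent c z

  Avoider : V G → Set
  Avoider a = Inner a × ¬ Meets a

  avoider∉P : Avoider a → a ∉ Pl
  avoider∉P (ia , ¬meets) k = ¬meets (_ , k , ia , ~-refl)

  meeting-components-linked : Meets a → Meets b → a ~ b
  meeting-components-linked (z₁ , k₁ , i₁ , a~z₁) (z₂ , k₂ , i₂ , b~z₂) =
    ~-trans a~z₁ (~-trans interior (~-sym b~z₂))
    where
      interior : z₁ ~ z₂
      interior = path-interior-linked Tree⊆G (path-departs-before-end P P!) (start∉drop1 P P!)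
        (∈-drop1 P k₁ (proj₁ i₁)) (∈-drop1 P k₂ (proj₁ i₂)) i₁ i₂

  others-avoid : Meets a → ¬ a ~ b → ¬ Meets b
  others-avoid m a≁b m′ = a≁b (meeting-components-linked m m′)

  off-fundamental-cycle-linked : Adj G x y → ¬ Tree x y → Walk G Tree x y Q → Unique Q →
    u ∈ Q → v ∈ Q → a ∉ Q → b ∉ Q → a ~ b
  off-fundamental-cycle-linked {x} {y} {Q} e ¬t W Q! u∈Q v∈Q a∉Q b∉Q =
    let ws , W′ = fundamental x y e ¬t _ _ (a∉Q ∘ on-cycle) (b∉Q ∘ on-cycle) in
    ws , induced-mono inner W′
    where
      on-cycle : OnFundCycle G T x y z → z ∈ Q
      on-cycle (_ , W′ , vs! , k) = subst (_ ∈_) (path-unique W′ W vs! Q!) k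
      inner : ¬ OnFundCycle G T x y z → Inner z
      inner z∉C = (λ { refl → z∉C (Q , W , Q! , u∈Q) }) , (λ { refl → z∉C (Q , W , Q! , v∈Q) })

  module Avoiding (d : V G) (d-avoids : Avoider d) where

    D : V G → Set
    D = InComponent d

    D∉P : z ∈ Pl → ¬ D z
    D∉P k Dz = proj₂ d-avoids (_ , k , Dz)

    Side : V G → V G → Set
    Side c x = Σ[ ws ∈ List (V G) ] Walk G (Departing D Tree) x c ws × Unique ws

    side : ∀ {ws} → Walk G (Departing D Tree) x c ws → Side c x
    side W = let ws , W′ , ws! , _ = toPath W in ws , W′ , ws!

    side-refl : Side c c
    side-refl = side nil

    side-start : Side c x → x ≡ c ⊎ D x
    side-start (_ , W , _) = departing-vertices W (start∈ W)

    side-suffix : ((ws , _) : Side c x) → z ∈ ws → Side c z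
    side-suffix (_ , W , ws!) k = let ws , W′ , ws′! , _ = suffix W ws! k in ws , W′ , ws′!

    through-u : Side u x → Σ[ ws ∈ List (V G) ] Walk G Tree x v ws × Unique ws ×
      u ∈ ws × (∀ {z} → z ∈ ws → z ∈ Pl ⊎ Side u z)
    through-u X@(xs , W , xs!) =
      xs ++ drop 1 Pl , map proj₂ W ++ʷ P , Unique.++⁺ xs! (Unique.drop⁺ 1 P!) disjoint ,
      ∈-++⁺ˡ (end∈ W) , [ inj₂ ∘ side-suffix X , inj₁ ∘ drop1⊆ ]′ ∘ ∈-++⁻ xs
      where
        disjoint : Disjoint xs (drop 1 Pl)
        disjoint (k₁ , k₂) with departing-vertices W k₁
        ... | inj₁ refl = start∉drop1 P P! k₂
        ... | inj₂ Dz = D∉P (drop1⊆ k₂) Dz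

    sides-disjoint : Side u x → Side v x → ⊥
    sides-disjoint X (ys , Y , ys!)
      with ws , W , ws! , u∈ws , _ ← through-u X
      with departing-vertices Y (subst (u ∈_) (path-unique W (map proj₂ Y) ws! ys!) u∈ws)
    ... | inj₁ u≡v = u≢v u≡v
    ... | inj₂ (u-inner , _) = proj₁ u-inner refl

    side-split : D x → Side u x ⊎ Side v x
    side-split {x} (_ , d~x) with exit-component Tree⊆G (proj₂ (tree-spans x u)) (inj₁ refl) d~x
    ... | _ , inj₁ refl , _ , W , _ = inj₁ (side W)
    ... | _ , inj₂ refl , _ , W , _ = inj₂ (side W)

    -- No cut vertex: G - o still joins d to t, and such a walk can only leave D at t.
    reach : ∀ {t o} → Terminal t → t ≢ o → d ≢ o → (∀ {w} → Terminal w → w ≢ o → w ≡ t) →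
      Σ[ ws ∈ List (V G) ] Walk G (Departing D (Adj G)) d t ws
    reach t-terminal t≢o d≢o pick
      with _ , W ← no-cut-vertex _ _ _ d≢o t≢o
      with w , w-terminal , ws , W′ , ws⊆ ← exit-component proj₁ W t-terminal ~-refl
      with refl ← pick w-terminal (induced-vertices W d≢o (ws⊆ (end∈ W′))) =
      ws , map (λ { (Dx , e , _) → Dx , e }) W′

    crossing : Σ[ x ∈ V G ] Σ[ y ∈ V G ] Side u x × Side v y × Adj G x y × (D x ⊎ D y)
    crossing with side-split (proj₁ d-avoids , ~-refl)
    ... | inj₁ d-u =
      let x , y , Dx , sx , sy , e =
            crossing-edge sides-disjoint side-split
              (proj₂ (reach (inj₂ refl) (u≢v ∘ sym) (proj₁ (proj₁ d-avoids)) terminal-≢u)) d-u side-refl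
      in x , y , sx , sy , e , inj₁ Dx
    ... | inj₂ d-v =
      let x , y , Dx , sx , sy , e =
            crossing-edge (λ sv su → sides-disjoint su sv) (swap ∘ side-split)
              (proj₂ (reach (inj₁ refl) u≢v (proj₂ (proj₁ d-avoids)) terminal-≢v)) d-v side-refl
      in y , x , sy , sx , Adj-sym e , inj₂ Dx

    not-tree-edge : Side u x → Side v y → D x ⊎ D y → ¬ Tree x y
    not-tree-edge X (_ , Y , _) (inj₁ Dx) t = sides-disjoint X (side (cons (Dx , t) Y))
    not-tree-edge (_ , X , _) Y (inj₂ Dy) t = sides-disjoint (side (cons (Dy , Tree-sym t) X)) Y

    fundamental-path : Side u x → Side v y → Σ[ Q ∈ List (V G) ] Walk G Tree x y Q × Unique Q ×
      u ∈ Q × v ∈ Q × (∀ {z} → z ∈ Q → z ∈ Pl ⊎ D z)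
    fundamental-path X Y@(ys , Yw , ys!) with ws , W , ws! , u∈ws , ws-sides ← through-u X =
      ws ++ drop 1 (reverse ys) , W ++ʷ reverseʷ Tree-sym (map proj₂ Yw) ,
      Unique.++⁺ ws! (Unique.drop⁺ 1 (unique-reverse ys!)) disjoint ,
      ∈-++⁺ˡ u∈ws , ∈-++⁺ˡ (end∈ W) , [ on-u-side , on-v-side ∘ on-Y ]′ ∘ ∈-++⁻ ws
      where
        on-Y : z ∈ drop 1 (reverse ys) → z ∈ ys
        on-Y = Any.reverse⁻ {xs = ys} ∘ drop1⊆
        on-u-side : z ∈ ws → z ∈ Pl ⊎ D z
        on-u-side k with ws-sides k
        ... | inj₁ k′ = inj₁ k′
        ... | inj₂ Z with side-start Z
        ...   | inj₁ refl = inj₁ (start∈ P)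
        ...   | inj₂ Dz = inj₂ Dz
        on-v-side : z ∈ ys → z ∈ Pl ⊎ D z
        on-v-side k with departing-vertices Yw k
        ... | inj₁ refl = inj₁ (end∈ P)
        ... | inj₂ Dz = inj₂ Dz
        disjoint : Disjoint ws (drop 1 (reverse ys))
        disjoint (k₁ , k₂) with departing-vertices Yw (on-Y k₂) | ws-sides k₁
        ... | inj₁ refl | _ = start∉drop1 (reverseʷ Tree-sym (map proj₂ Yw)) (unique-reverse ys!) k₂
        ... | inj₂ Dz | inj₁ k = D∉P k Dz
        ... | inj₂ _ | inj₂ Z = sides-disjoint Z (side-suffix Y (on-Y k₂))

    avoiders-linked : Avoider a → Avoider b → ¬ d ~ a → ¬ d ~ b → a ~ b
    avoiders-linked A B d≁a d≁b
      with x , y , X , Y , e , Dx⊎Dy ← crossing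
      with Q , W , Q! , u∈Q , v∈Q , Q-vertices ← fundamental-path X Y =
      off-fundamental-cycle-linked e (not-tree-edge X Y Dx⊎Dy) W Q! u∈Q v∈Q (off A d≁a) (off B d≁b)
      where
        off : Avoider c → ¬ d ~ c → c ∉ Q
        off C d≁c = [ avoider∉P C , d≁c ∘ proj₂ ]′ ∘ Q-vertices

  three-avoiders-impossible : Avoider a → Avoider b → Avoider c → ¬ a ~ b → ¬ a ~ c → ¬ b ~ c → ⊥
  three-avoiders-impossible {a} A B C a≁b a≁c b≁c = b≁c (Avoiding.avoiders-linked a A B C a≁b a≁c)

  decide-meets : ∀ a → (Dec (Meets a) → ⊥) → ⊥
  decide-meets _ = ¬¬-excluded-middle

  no-four-components : Inner a → Inner b → Inner c → Inner z →
    ¬ a ~ b → ¬ a ~ c → ¬ a ~ z → ¬ b ~ c → ¬ b ~ z → ¬ c ~ z → ⊥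
  no-four-components {a} {b} {c} ia ib ic iz a≁b a≁c a≁z b≁c b≁z c≁z = decide-meets a λ where
    (yes ma) → three-avoiders-impossible
      (ib , others-avoid ma a≁b) (ic , others-avoid ma a≁c) (iz , others-avoid ma a≁z) b≁c b≁z c≁z
    (no ¬ma) → decide-meets b λ where
      (yes mb) → three-avoiders-impossible
        (ia , ¬ma) (ic , others-avoid mb b≁c) (iz , others-avoid mb b≁z) a≁c a≁z c≁z
      (no ¬mb) → decide-meets c λ where
        (yes mc) → three-avoiders-impossible (ia , ¬ma) (ib , ¬mb) (iz , others-avoid mc c≁z) a≁b a≁z b≁z
        (no ¬mc) → three-avoiders-impossible (ia , ¬ma) (ib , ¬mb) (ic , ¬mc) a≁b a≁c b≁c

  avoiders-linked-by-P : Adj G u v → ¬ Tree u v → Avoider a → Avoider b → a ~ b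
  avoiders-linked-by-P e ¬t A B =
    off-fundamental-cycle-linked e ¬t P P! (start∈ P) (end∈ P) (avoider∉P A) (avoider∉P B)

  no-edge-and-three-components : Adj G u v → Inner a → Inner b → Inner c →
    ¬ a ~ b → ¬ a ~ c → ¬ b ~ c → ⊥
  no-edge-and-three-components {a} {b} e ia ib ic a≁b a≁c b≁c with T u v Bool.≟ true
  ... | yes t = three-avoiders-impossible (ia , nobody-meets) (ib , nobody-meets) (ic , nobody-meets) a≁b a≁c b≁c
    where
      nobody-meets : ¬ Meets z
      nobody-meets (_ , k , (z≢u , z≢v) , _)
        with subst (_ ∈_) (path-unique P (cons t nil) P! ((u≢v ∷ []) ∷ [] ∷ [])) k
      ... | here z≡u = z≢u z≡u
      ... | there (here z≡v) = z≢v z≡v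
  ... | no ¬t = decide-meets a λ where
    (yes ma) → b≁c (avoiders-linked-by-P e ¬t (ib , others-avoid ma a≁b) (ic , others-avoid ma a≁c))
    (no ¬ma) → decide-meets b λ where
      (yes mb) → a≁c (avoiders-linked-by-P e ¬t (ia , ¬ma) (ic , others-avoid mb b≁c))
      (no ¬mb) → a≁b (avoiders-linked-by-P e ¬t (ia , ¬ma) (ib , ¬mb))

  no-four-bridges : (r₀ r₁ r₂ r₃ : BridgeRep G u v) →
    ¬ SameBridge G u v r₀ r₁ → ¬ SameBridge G u v r₀ r₂ → ¬ SameBridge G u v r₀ r₃ →
    ¬ SameBridge G u v r₁ r₂ → ¬ SameBridge G u v r₁ r₃ → ¬ SameBridge G u v r₂ r₃ → ⊥
  no-four-bridges (edgeBr _) (edgeBr _) _ _ n₀₁ _ _ _ _ _ = n₀₁ tt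
  no-four-bridges (edgeBr _) _ (edgeBr _) _ _ n₀₂ _ _ _ _ = n₀₂ tt
  no-four-bridges (edgeBr _) _ _ (edgeBr _) _ _ n₀₃ _ _ _ = n₀₃ tt
  no-four-bridges _ (edgeBr _) (edgeBr _) _ _ _ _ n₁₂ _ _ = n₁₂ tt
  no-four-bridges _ (edgeBr _) _ (edgeBr _) _ _ _ _ n₁₃ _ = n₁₃ tt
  no-four-bridges _ _ (edgeBr _) (edgeBr _) _ _ _ _ _ n₂₃ = n₂₃ tt
  no-four-bridges (edgeBr e) (compBr _ p₁ q₁) (compBr _ p₂ q₂) (compBr _ p₃ q₃) _ _ _ n₁₂ n₁₃ n₂₃ =
    no-edge-and-three-components e (p₁ , q₁) (p₂ , q₂) (p₃ , q₃) n₁₂ n₁₃ n₂₃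
  no-four-bridges (compBr _ p₀ q₀) (edgeBr e) (compBr _ p₂ q₂) (compBr _ p₃ q₃) _ n₀₂ n₀₃ _ _ n₂₃ =
    no-edge-and-three-components e (p₀ , q₀) (p₂ , q₂) (p₃ , q₃) n₀₂ n₀₃ n₂₃
  no-four-bridges (compBr _ p₀ q₀) (compBr _ p₁ q₁) (edgeBr e) (compBr _ p₃ q₃) n₀₁ _ n₀₃ _ n₁₃ _ =
    no-edge-and-three-components e (p₀ , q₀) (p₁ , q₁) (p₃ , q₃) n₀₁ n₀₃ n₁₃
  no-four-bridges (compBr _ p₀ q₀) (compBr _ p₁ q₁) (compBr _ p₂ q₂) (edgeBr e) n₀₁ n₀₂ _ n₁₂ _ _ =
    no-edge-and-three-components e (p₀ , q₀) (p₁ , q₁) (p₂ , q₂) n₀₁ n₀₂ n₁₂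
  no-four-bridges (compBr _ p₀ q₀) (compBr _ p₁ q₁) (compBr _ p₂ q₂) (compBr _ p₃ q₃) =
    no-four-components (p₀ , q₀) (p₁ , q₁) (p₂ , q₂) (p₃ , q₃)

lemma6 : (G : Graph) → TwoConnected G → (u v : V G) → TwoVertexCut G u v →
    HasFundamentalTutteTree G → AtMostThreeBridges G u v
lemma6 G (_ , _ , no-cut-vertex) u v (u≢v , _) (T , tree , fundamental) (f , distinct)
  with _ , P , P! , _ ← Walks.toPath G (proj₂ (proj₁ (proj₂ (proj₂ tree)) u v)) =
  TutteTree.no-four-bridges G u v u≢v T tree fundamental no-cut-vertex P P!
    (f zero) (f (suc zero)) (f (suc (suc zero))) (f (suc (suc (suc zero))))
    (distinct _ _ λ ()) (distinct _ _ λ ()) (distinct _ _ λ ())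
    (distinct _ _ λ ()) (distinct _ _ λ ()) (distinct _ _ λ ())
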